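{- Let $k,\ell\in\mathbb{Z}_{>0}$, $s\in\{0,\dotsc,\lfloor k/2\rfloor\}$, $t\in\{0,\dotsc,\lfloor \ell/2\rfloor\}$ and $n\in\mathbb{Z}_{>0}$. Let $\mathcal{E}(s,t,n)=\{(u,v,\alpha,\beta)\in\mathbb{Z}_{\geq 0}^4: u\leq s,\ v\leq t,\ \alpha+\beta\leq u+v+n-s-t-1\}$. If complex numbers $\vec{a}=(a_r)_{0\leq r\leq n}$ satisfy \[ \sum_{r=0}^na_r\binom{r}{\alpha}\binom{n-r}{\beta}(k+r-u-1)!\,(\ell+n-r-v-1)!=0 \] for all $(u,v,\alpha,\beta)\in\mathcal{E}(s,t,n)$, then there exists $\lambda\in\mathbb{C}$ such that \[ a_r=\lambda(-1)^r\binom{k+n-s-1}{n-r}\binom{\ell+n-t-1}{r}\quad\text{for all } r\in\{0,\dotsc,n\}. \] -}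

module Defs where

open import Level using (Level; _⊔_)
open import Algebra.Bundles using (CommutativeRing)
open import Data.Nat using (ℕ; zero; suc)
open import Data.Product using (∃)
open import Relation.Nullary using (¬_)

module RingOps {c ℓ : Level} (R : CommutativeRing c ℓ) where
  open CommutativeRing R using (Carrier; 0#; 1#; _+_; -_)

  fromℕ : ℕ → Carrier
  fromℕ zero    = 0#
  fromℕ (suc n) = 1# + fromℕ n

  sumTo : (ℕ → Carrier) → ℕ → Carrier
  sumTo f zero    = f zero
  sumTo f (suc n) = sumTo f n + f (suc n)

  sign : ℕ → Carrier
  sign zero    = 1#
  sign (suc r) = - sign r

-- A field of characteristic zero (stands in for ℂ).
record CharZeroField (c ℓ : Level) : Set (Level.suc (c ⊔ ℓ)) where
  field
    commRing : CommutativeRing c ℓ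
  open CommutativeRing commRing public hiding (zero)
  open RingOps commRing public
  field
    charZero : ∀ n → ¬ (fromℕ (suc n) ≈ 0#)
    inverse  : ∀ x → ¬ (x ≈ 0#) → ∃ λ y → x * y ≈ 1#

open CharZeroField {{...}} public
  using (Carrier; _≈_; 0#; fromℕ; sumTo; sign)
  renaming (_*_ to _·_)

{-# OPTIONS --safe #-}
module Submission where

-- With A = k - s - 1 and B = l - t - 1 (natural numbers since s ≤ k/2 forces s < k) and
-- b_r = a_r (A+r)! (B+n-r)!, they say that the binomial moments Σ_r b_r C(r,α) vanish for α < n.
-- This system is triangular in (b_0, …, b_n), so its solutions form a line, spanned by
-- (-1)^r C(n,r) because Σ_{r ≤ n+1} (-1)^r C(n+1,r) h(r) = Σ_{r ≤ n} (-1)^r C(n,r) (h(r) - h(r+1))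
-- and the difference operator lowers the degree of h(r) = C(r,α). Finally C(n,r) / ((A+r)! (B+n-r)!)
-- is proportional to C(A+n,n-r) C(B+n,r), and characteristic zero lets us divide by the factorials.

open import Level using (Level)
open import Algebra.Bundles using (CommutativeRing)
open import Data.Nat using (ℕ; zero; suc; _∸_; _≤_; _<_; _/_; _!; NonZero; s≤s; z≤n; >-nonZero)
import Data.Nat as ℕ
open import Data.Nat.Properties using (≤-refl; <⇒≤; m≤n⇒m≤1+n; m≤n⇒m<n∨m≡n; m<n⇒m<1+n; n<1+n)
open import Data.Nat.Combinatorics
  using (_C_; nCn≡1; k>n⇒nCk≡0; nCk+nC[k+1]≡[n+1]C[k+1]; nCk≡n!/k![n-k]!; k![n∸k]!∣n!)
open import Data.Nat.DivMod using (m/n*n≡m; m/n<m)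
open import Data.Nat.Tactic.RingSolver using (solve-∀)
open import Data.Product using (∃; _,_; proj₁; proj₂; map₂)
open import Data.Sum using (inj₁; inj₂)
open import Relation.Binary.PropositionalEquality as ≡ using (_≡_)
open import Defs using (module RingOps; CharZeroField)

module BinomialMoments {c ℓ : Level} (R : CommutativeRing c ℓ) where
  open CommutativeRing R hiding (zero)
  open RingOps R
  open import Algebra.Properties.Ring ring
    using (x∙y⁻¹≈ε⇒x≈y; -‿+-comm; [y-z]x≈yx-zx; -‿distribˡ-*; -‿distribʳ-*; -‿involutive)
  open import Algebra.Properties.Semiring.Mult semiring using (_×_; ×-homo-+; ×1-homo-*)
  open import Algebra.Properties.CommutativeSemigroup +-commutativeSemigroup
    using () renaming (interchange to +-interchange)
  open import Algebra.Properties.CommutativeSemigroup *-commutativeSemigroup using (xy∙z≈y∙xz)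
  open import Relation.Binary.Reasoning.Setoid setoid

  fromℕ≡×1# : ∀ n → fromℕ n ≡ n × 1#
  fromℕ≡×1# zero    = ≡.refl
  fromℕ≡×1# (suc n) = ≡.cong (1# +_) (fromℕ≡×1# n)

  fromℕ-cong : ∀ {m n} → m ≡ n → fromℕ m ≈ fromℕ n
  fromℕ-cong m≡n = reflexive (≡.cong fromℕ m≡n)

  fromℕ-homo-+ : ∀ m n → fromℕ (m ℕ.+ n) ≈ fromℕ m + fromℕ n
  fromℕ-homo-+ m n rewrite fromℕ≡×1# (m ℕ.+ n) | fromℕ≡×1# m | fromℕ≡×1# n = ×-homo-+ 1# m n

  fromℕ-homo-* : ∀ m n → fromℕ (m ℕ.* n) ≈ fromℕ m * fromℕ n
  fromℕ-homo-* m n rewrite fromℕ≡×1# (m ℕ.* n) | fromℕ≡×1# m | fromℕ≡×1# n = ×1-homo-* m n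

  fromℕ-1 : fromℕ 1 ≈ 1#
  fromℕ-1 = +-identityʳ 1#

  fromℕ-C-pascal : ∀ n k → fromℕ (suc n C suc k) ≈ fromℕ (n C k) + fromℕ (n C suc k)
  fromℕ-C-pascal n k = trans (fromℕ-cong (≡.sym (nCk+nC[k+1]≡[n+1]C[k+1] n k)))
                             (fromℕ-homo-+ (n C k) (n C suc k))

  fromℕ-C-beyond : ∀ {n k} → n < k → fromℕ (n C k) ≈ 0#
  fromℕ-C-beyond n<k = fromℕ-cong (k>n⇒nCk≡0 n<k)

  sign*sign≈1 : ∀ n → sign n * sign n ≈ 1#
  sign*sign≈1 zero    = *-identityʳ 1#
  sign*sign≈1 (suc n) = begin
    - sign n * - sign n     ≈⟨ -‿distribˡ-* (sign n) (- sign n) ⟨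
    - (sign n * - sign n)   ≈⟨ -‿cong (-‿distribʳ-* (sign n) (sign n)) ⟨
    - - (sign n * sign n)   ≈⟨ -‿involutive _ ⟩
    sign n * sign n         ≈⟨ sign*sign≈1 n ⟩
    1#                      ∎

  sumTo-cong : ∀ {f g} n → (∀ r → r ≤ n → f r ≈ g r) → sumTo f n ≈ sumTo g n
  sumTo-cong zero    f≈g = f≈g 0 z≤n
  sumTo-cong (suc n) f≈g =
    +-cong (sumTo-cong n (λ r r≤n → f≈g r (m≤n⇒m≤1+n r≤n))) (f≈g (suc n) ≤-refl)

  sumTo-distrib-+ : ∀ f g n → sumTo (λ r → f r + g r) n ≈ sumTo f n + sumTo g n
  sumTo-distrib-+ f g zero    = refl
  sumTo-distrib-+ f g (suc n) = trans (+-congʳ (sumTo-distrib-+ f g n)) (+-interchange _ _ _ _)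

  sumTo-distrib-- : ∀ f g n → sumTo (λ r → f r - g r) n ≈ sumTo f n - sumTo g n
  sumTo-distrib-- f g zero    = refl
  sumTo-distrib-- f g (suc n) = trans (+-congʳ (sumTo-distrib-- f g n))
                                      (trans (+-interchange _ _ _ _) (+-congˡ (-‿+-comm _ _)))

  sumTo-*ˡ : ∀ x f n → sumTo (λ r → x * f r) n ≈ x * sumTo f n
  sumTo-*ˡ x f zero    = refl
  sumTo-*ˡ x f (suc n) = trans (+-congʳ (sumTo-*ˡ x f n)) (sym (distribˡ x _ _))

  sumTo-suc : ∀ f n → sumTo f (suc n) ≈ f 0 + sumTo (λ r → f (suc r)) n
  sumTo-suc f zero    = refl
  sumTo-suc f (suc n) = trans (+-congʳ (sumTo-suc f n)) (+-assoc _ _ _)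

  altBinomial : ℕ → ℕ → Carrier
  altBinomial n r = sign r * fromℕ (n C r)

  altBinomial-diagonal : ∀ n → altBinomial n n ≈ sign n
  altBinomial-diagonal n = trans (*-congˡ (trans (fromℕ-cong (nCn≡1 n)) fromℕ-1)) (*-identityʳ _)

  altBinomial-beyond : ∀ n → altBinomial n (suc n) ≈ 0#
  altBinomial-beyond n = trans (*-congˡ (fromℕ-C-beyond (n<1+n n))) (zeroʳ _)

  altBinomial-pascal : ∀ n r → altBinomial (suc n) (suc r) ≈ altBinomial n (suc r) - altBinomial n r
  altBinomial-pascal n r = begin
    - sign r * fromℕ (suc n C suc r)                         ≈⟨ *-congˡ (fromℕ-C-pascal n r) ⟩
    - sign r * (fromℕ (n C r) + fromℕ (n C suc r))           ≈⟨ distribˡ _ _ _ ⟩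
    - sign r * fromℕ (n C r) + - sign r * fromℕ (n C suc r)  ≈⟨ +-comm _ _ ⟩
    - sign r * fromℕ (n C suc r) + - sign r * fromℕ (n C r)  ≈⟨ +-congˡ (-‿distribˡ-* _ _) ⟨
    altBinomial n (suc r) - altBinomial n r                  ∎

  sumTo-altBinomial-suc : ∀ n (h : ℕ → Carrier) →
    sumTo (λ r → altBinomial (suc n) r * h r) (suc n)
      ≈ sumTo (λ r → altBinomial n r * h r) n - sumTo (λ r → altBinomial n r * h (suc r)) n
  sumTo-altBinomial-suc n h = begin
    sumTo (λ r → altBinomial (suc n) r * h r) (suc n)
      ≈⟨ sumTo-suc (λ r → altBinomial (suc n) r * h r) n ⟩
    altBinomial n 0 * h 0 + sumTo (λ r → altBinomial (suc n) (suc r) * h (suc r)) n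
      ≈⟨ +-congˡ (sumTo-cong n (λ r _ → trans (*-congʳ (altBinomial-pascal n r)) ([y-z]x≈yx-zx _ _ _))) ⟩
    altBinomial n 0 * h 0 + sumTo (λ r → altBinomial n (suc r) * h (suc r) - altBinomial n r * h (suc r)) n
      ≈⟨ +-congˡ (sumTo-distrib-- _ _ n) ⟩
    altBinomial n 0 * h 0 + (sumTo (λ r → altBinomial n (suc r) * h (suc r)) n - T)
      ≈⟨ +-assoc _ _ _ ⟨
    altBinomial n 0 * h 0 + sumTo (λ r → altBinomial n (suc r) * h (suc r)) n - T
      ≈⟨ +-congʳ (sumTo-suc (λ r → altBinomial n r * h r) n) ⟨
    sumTo (λ r → altBinomial n r * h r) (suc n) - T
      ≈⟨ +-congʳ (trans (+-congˡ (trans (*-congʳ (altBinomial-beyond n)) (zeroˡ _))) (+-identityʳ _)) ⟩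
    sumTo (λ r → altBinomial n r * h r) n - T
      ∎
    where
    T : Carrier
    T = sumTo (λ r → altBinomial n r * h (suc r)) n

  moment : (ℕ → Carrier) → ℕ → ℕ → Carrier
  moment b n α = sumTo (λ r → b r * fromℕ (r C α)) n

  moment-pascal : ∀ b n α →
    sumTo (λ r → b r * fromℕ (suc r C suc α)) n ≈ moment b n α + moment b n (suc α)
  moment-pascal b n α =
    trans (sumTo-cong n (λ r _ → trans (*-congˡ (fromℕ-C-pascal r α)) (distribˡ _ _ _)))
          (sumTo-distrib-+ _ _ n)

  moment-beyond : ∀ b {n α} → n < α → moment b n α ≈ 0#
  moment-beyond b {zero}  0<α = trans (*-congˡ (fromℕ-C-beyond 0<α)) (zeroʳ _)
  moment-beyond b {suc n} n<α =
    trans (+-cong (moment-beyond b (<⇒≤ n<α)) (trans (*-congˡ (fromℕ-C-beyond n<α)) (zeroʳ _)))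
          (+-identityʳ 0#)

  moment-diagonal : ∀ b n → moment b n n ≈ b n
  moment-diagonal b zero    = trans (*-congˡ fromℕ-1) (*-identityʳ _)
  moment-diagonal b (suc n) = begin
    moment b n (suc n) + b (suc n) * fromℕ (suc n C suc n)
      ≈⟨ +-cong (moment-beyond b (n<1+n n)) (*-congˡ (trans (fromℕ-cong (nCn≡1 (suc n))) fromℕ-1)) ⟩
    0# + b (suc n) * 1#  ≈⟨ trans (+-identityˡ _) (*-identityʳ _) ⟩
    b (suc n)            ∎

  moment-altBinomial : ∀ n α → α < n → moment (altBinomial n) n α ≈ 0#
  moment-altBinomial (suc n) zero    _         =
    trans (sumTo-altBinomial-suc n (λ r → fromℕ (r C 0))) (-‿inverseʳ _)
  moment-altBinomial (suc n) (suc α) (s≤s α<n) = begin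
    moment (altBinomial (suc n)) (suc n) (suc α)
      ≈⟨ sumTo-altBinomial-suc n (λ r → fromℕ (r C suc α)) ⟩
    moment (altBinomial n) n (suc α) - sumTo (λ r → altBinomial n r * fromℕ (suc r C suc α)) n
      ≈⟨ +-congˡ (-‿cong (trans (moment-pascal (altBinomial n) n α)
                                (trans (+-congʳ (moment-altBinomial n α α<n)) (+-identityˡ _)))) ⟩
    moment (altBinomial n) n (suc α) - moment (altBinomial n) n (suc α)
      ≈⟨ -‿inverseʳ _ ⟩
    0# ∎

  vanishing-moments⇒vanishing : ∀ b n → b n ≈ 0# → (∀ α → α < n → moment b n α ≈ 0#) →
                                ∀ r → r ≤ n → b r ≈ 0#
  vanishing-moments⇒vanishing b zero    b₀≈0 _         .zero z≤n = b₀≈0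
  vanishing-moments⇒vanishing b (suc n) b₁₊ₙ≈0 moments≈0 r    r≤1+n with m≤n⇒m<n∨m≡n r≤1+n
  ... | inj₂ ≡.refl    = b₁₊ₙ≈0
  ... | inj₁ (s≤s r≤n) = vanishing-moments⇒vanishing b n bₙ≈0 lower-moments≈0 r r≤n
    where
    drop-top : ∀ α → moment b (suc n) α ≈ moment b n α
    drop-top α = trans (+-congˡ (trans (*-congʳ b₁₊ₙ≈0) (zeroˡ _))) (+-identityʳ _)
    lower-moments≈0 : ∀ α → α < n → moment b n α ≈ 0#
    lower-moments≈0 α α<n = trans (sym (drop-top α)) (moments≈0 α (m<n⇒m<1+n α<n))
    bₙ≈0 : b n ≈ 0#
    bₙ≈0 = begin
      b n                 ≈⟨ moment-diagonal b n ⟨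
      moment b n n        ≈⟨ drop-top n ⟨
      moment b (suc n) n  ≈⟨ moments≈0 n (n<1+n n) ⟩
      0#                  ∎

  vanishing-moments⇒∝altBinomial : ∀ b n → (∀ α → α < n → moment b n α ≈ 0#) →
                                   ∀ r → r ≤ n → b r ≈ (sign n * b n) * altBinomial n r
  vanishing-moments⇒∝altBinomial b n moments≈0 r r≤n =
    x∙y⁻¹≈ε⇒x≈y _ _ (vanishing-moments⇒vanishing d n dₙ≈0 d-moments≈0 r r≤n)
    where
    μ : Carrier
    μ = sign n * b n
    d : ℕ → Carrier
    d r = b r - μ * altBinomial n r
    dₙ≈0 : d n ≈ 0#
    dₙ≈0 = begin
      b n - μ * altBinomial n n      ≈⟨ +-congˡ (-‿cong (*-congˡ (altBinomial-diagonal n))) ⟩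
      b n - (sign n * b n) * sign n  ≈⟨ +-congˡ (-‿cong (xy∙z≈y∙xz (sign n) (b n) (sign n))) ⟩
      b n - b n * (sign n * sign n)  ≈⟨ +-congˡ (-‿cong (trans (*-congˡ (sign*sign≈1 n)) (*-identityʳ _))) ⟩
      b n - b n                      ≈⟨ -‿inverseʳ _ ⟩
      0#                             ∎
    d-moments≈0 : ∀ α → α < n → moment d n α ≈ 0#
    d-moments≈0 α α<n = begin
      moment d n α
        ≈⟨ sumTo-cong n (λ r _ → trans ([y-z]x≈yx-zx _ _ _) (+-congˡ (-‿cong (*-assoc _ _ _)))) ⟩
      sumTo (λ r → b r * fromℕ (r C α) - μ * (altBinomial n r * fromℕ (r C α))) n
        ≈⟨ trans (sumTo-distrib-- _ _ n) (+-congˡ (-‿cong (sumTo-*ˡ μ _ n))) ⟩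
      moment b n α - μ * moment (altBinomial n) n α
        ≈⟨ +-cong (moments≈0 α α<n) (-‿cong (trans (*-congˡ (moment-altBinomial n α α<n)) (zeroʳ μ))) ⟩
      0# - 0#
        ≈⟨ -‿inverseʳ 0# ⟩
      0# ∎

-- Imported only now: ℕ's _+_ and _*_ would clash with the ring operations of the module above.
open import Defs using (Carrier; _≈_; 0#; fromℕ; sumTo; sign; _·_)
open import Data.Nat using (_+_; _*_)
open import Data.Nat.Properties
  using (≤-trans; ≤-<-trans; ≤-reflexive; +-comm; +-monoʳ-≤; m∸n≤m; m≤n+m; +-∸-assoc; +-∸-comm;
         ∸-+-assoc; m∸[m∸n]≡n; *-cancelʳ-≡; _!*_!≢0)

m≤n/2⇒m<n : ∀ {m n} → 0 < n → m ≤ n / 2 → m < n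
m≤n/2⇒m<n {n = n} 0<n m≤n/2 = ≤-<-trans m≤n/2 (m/n<m n 2 {{>-nonZero 0<n}} (s≤s (s≤s z≤n)))

m+n∸o∸1≡m∸suc[o]+n : ∀ {m o} n → o < m → m + n ∸ o ∸ 1 ≡ m ∸ suc o + n
m+n∸o∸1≡m∸suc[o]+n {m} {o} n o<m =
  ≡.trans (∸-+-assoc (m + n) o 1) (≡.trans (≡.cong (m + n ∸_) (+-comm o 1)) (+-∸-comm n o<m))

nCk*[k!*j!]≡n! : ∀ {n k j} → k ≤ n → n ∸ k ≡ j → (n C k) * (k ! * j !) ≡ n !
nCk*[k!*j!]≡n! {n} {k} k≤n ≡.refl =
  ≡.trans (≡.cong (_* (k ! * (n ∸ k) !)) (nCk≡n!/k![n-k]! k≤n))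
          (m/n*n≡m {{k !* (n ∸ k) !≢0}} (k![n∸k]!∣n! k≤n))

-- Both sides are (A+n)! (B+n)! n! / (r! (n-r)!).
C[A+n,n∸r]*C[B+n,r]*[A+r]!*[B+n∸r]!*n!≡nCr*[A+n]!*[B+n]! : ∀ A B {n r} → r ≤ n →
  ((A + n) C (n ∸ r)) * ((B + n) C r) * ((A + r) ! * (B + (n ∸ r)) !) * n !
    ≡ (n C r) * ((A + n) ! * (B + n) !)
C[A+n,n∸r]*C[B+n,r]*[A+r]!*[B+n∸r]!*n!≡nCr*[A+n]!*[B+n]! A B {n} {r} r≤n =
  *-cancelʳ-≡ _ _ (r ! * (n ∸ r) !) {{r !* (n ∸ r) !≢0}} (begin
    ((A + n) C (n ∸ r)) * ((B + n) C r) * ((A + r) ! * (B + (n ∸ r)) !) * n ! * (r ! * (n ∸ r) !)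
      ≡⟨ regroup ((A + n) C (n ∸ r)) ((B + n) C r) ((A + r) !) ((B + (n ∸ r)) !) (n !) (r !) ((n ∸ r) !) ⟩
    ((A + n) C (n ∸ r)) * ((n ∸ r) ! * (A + r) !) * (((B + n) C r) * (r ! * (B + (n ∸ r)) !)) * n !
      ≡⟨ ≡.cong₂ (λ x y → x * y * n !)
                 (nCk*[k!*j!]≡n! (≤-trans (m∸n≤m n r) (m≤n+m n A)) A+n∸[n∸r]≡A+r)
                 (nCk*[k!*j!]≡n! (≤-trans r≤n (m≤n+m n B)) (+-∸-assoc B r≤n)) ⟩
    (A + n) ! * (B + n) ! * n !
      ≡⟨ ≡.cong ((A + n) ! * (B + n) ! *_) (≡.sym (nCk*[k!*j!]≡n! r≤n ≡.refl)) ⟩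
    (A + n) ! * (B + n) ! * ((n C r) * (r ! * (n ∸ r) !))
      ≡⟨ swap ((A + n) ! * (B + n) !) (n C r) (r ! * (n ∸ r) !) ⟩
    (n C r) * ((A + n) ! * (B + n) !) * (r ! * (n ∸ r) !) ∎)
  where
  open ≡.≡-Reasoning
  A+n∸[n∸r]≡A+r : A + n ∸ (n ∸ r) ≡ A + r
  A+n∸[n∸r]≡A+r = ≡.trans (+-∸-assoc A (m∸n≤m n r)) (≡.cong (A +_) (m∸[m∸n]≡n r≤n))
  regroup : ∀ cA cB fA fB fn fr fd →
            cA * cB * (fA * fB) * fn * (fr * fd) ≡ cA * (fd * fA) * (cB * (fr * fB)) * fn
  regroup = solve-∀
  swap : ∀ x c y → x * (c * y) ≡ c * x * y
  swap = solve-∀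

module _ {c ℓ : Level} {{F : CharZeroField c ℓ}} where
  open CharZeroField F
    using (1#; commRing; charZero; inverse; setoid; refl; trans; *-congˡ; *-congʳ; *-assoc; *-identityʳ;
           *-commutativeMonoid)
  open BinomialMoments commRing using (fromℕ-homo-*; fromℕ-cong; moment; vanishing-moments⇒∝altBinomial)
  open import Algebra.Solver.CommutativeMonoid *-commutativeMonoid using (solve; _⊜_; _⊕_)
  open import Relation.Binary.Reasoning.Setoid setoid

  fromℕ-invertible : ∀ m .{{_ : NonZero m}} → ∃ λ (y : Carrier) → fromℕ m · y ≈ 1#
  fromℕ-invertible (suc m) = inverse (fromℕ (suc m)) (charZero m)

  ·-cancelʳ-fromℕ : ∀ m .{{_ : NonZero m}} {x y : Carrier} → x · fromℕ m ≈ y · fromℕ m → x ≈ y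
  ·-cancelʳ-fromℕ m {x} {y} x·m≈y·m with fromℕ-invertible m
  ... | m⁻¹ , m·m⁻¹≈1 = begin
    x                    ≈⟨ *-identityʳ x ⟨
    x · 1#               ≈⟨ *-congˡ m·m⁻¹≈1 ⟨
    x · (fromℕ m · m⁻¹)  ≈⟨ *-assoc x _ _ ⟨
    (x · fromℕ m) · m⁻¹  ≈⟨ *-congʳ x·m≈y·m ⟩
    (y · fromℕ m) · m⁻¹  ≈⟨ *-assoc y _ _ ⟩
    y · (fromℕ m · m⁻¹)  ≈⟨ *-congˡ m·m⁻¹≈1 ⟩
    y · 1#               ≈⟨ *-identityʳ y ⟩
    y                    ∎

  vanishing-weighted-moments⇒binomial-form : ∀ A B n (a : ℕ → Carrier) →
    (∀ α → α < n → moment (λ r → a r · fromℕ ((A + r) ! * (B + (n ∸ r)) !)) n α ≈ 0#) →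
    ∃ λ (λ' : Carrier) → ∀ r → r ≤ n →
      a r ≈ λ' · (sign r · fromℕ (((A + n) C (n ∸ r)) * ((B + n) C r)))
  vanishing-weighted-moments⇒binomial-form A B n a moments≈0 = (μ · fromℕ (n !)) · Q⁻¹ , a≈λ'·p
    where
    w : ℕ → ℕ
    w r = (A + r) ! * (B + (n ∸ r)) !
    b : ℕ → Carrier
    b r = a r · fromℕ (w r)
    μ : Carrier
    μ = sign n · b n
    Q : ℕ
    Q = (A + n) ! * (B + n) !
    Q-invertible : ∃ λ (y : Carrier) → fromℕ Q · y ≈ 1#
    Q-invertible = fromℕ-invertible Q {{(A + n) !* (B + n) !≢0}}
    Q⁻¹ : Carrier
    Q⁻¹ = proj₁ Q-invertible
    binomials : ℕ → ℕ
    binomials r = ((A + n) C (n ∸ r)) * ((B + n) C r)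
    a≈λ'·p : ∀ r → r ≤ n → a r ≈ ((μ · fromℕ (n !)) · Q⁻¹) · (sign r · fromℕ (binomials r))
    a≈λ'·p r r≤n = ·-cancelʳ-fromℕ (w r) {{(A + r) !* (B + (n ∸ r)) !≢0}} (begin
      a r · fromℕ (w r)
        ≈⟨ vanishing-moments⇒∝altBinomial b n moments≈0 r r≤n ⟩
      μ · (sign r · fromℕ (n C r))
        ≈⟨ *-assoc μ _ _ ⟨
      (μ · sign r) · fromℕ (n C r)
        ≈⟨ *-identityʳ _ ⟨
      (μ · sign r) · fromℕ (n C r) · 1#
        ≈⟨ *-congˡ (proj₂ Q-invertible) ⟨
      (μ · sign r) · fromℕ (n C r) · (fromℕ Q · Q⁻¹)
        ≈⟨ solve 5 (λ x s c q q⁻¹ → ((x ⊕ s) ⊕ c) ⊕ (q ⊕ q⁻¹) ⊜ ((x ⊕ s) ⊕ (c ⊕ q)) ⊕ q⁻¹)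
                 refl μ (sign r) _ _ _ ⟩
      (μ · sign r) · (fromℕ (n C r) · fromℕ Q) · Q⁻¹
        ≈⟨ *-congʳ (*-congˡ (fromℕ-homo-* (n C r) Q)) ⟨
      (μ · sign r) · fromℕ ((n C r) * Q) · Q⁻¹
        ≈⟨ *-congʳ (*-congˡ (fromℕ-cong
             (C[A+n,n∸r]*C[B+n,r]*[A+r]!*[B+n∸r]!*n!≡nCr*[A+n]!*[B+n]! A B r≤n))) ⟨
      (μ · sign r) · fromℕ (binomials r * w r * n !) · Q⁻¹
        ≈⟨ *-congʳ (*-congˡ (trans (fromℕ-homo-* (binomials r * w r) (n !))
                                   (*-congʳ (fromℕ-homo-* (binomials r) (w r))))) ⟩
      (μ · sign r) · (fromℕ (binomials r) · fromℕ (w r) · fromℕ (n !)) · Q⁻¹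
        ≈⟨ solve 6 (λ x s c v f q⁻¹ →
                      ((x ⊕ s) ⊕ ((c ⊕ v) ⊕ f)) ⊕ q⁻¹ ⊜ (((x ⊕ f) ⊕ q⁻¹) ⊕ (s ⊕ c)) ⊕ v)
                 refl μ (sign r) _ _ _ _ ⟩
      ((μ · fromℕ (n !)) · Q⁻¹) · (sign r · fromℕ (binomials r)) · fromℕ (w r)
        ∎)

factorial-weights-reindex : ∀ {k l s t n r} α → s < k → t < l → r ≤ n →
  (k ∸ suc s + r) ! * (l ∸ suc t + (n ∸ r)) ! * (r C α)
    ≡ (r C α) * ((n ∸ r) C 0) * ((k + r ∸ s ∸ 1) !) * ((l + n ∸ r ∸ t ∸ 1) !)
factorial-weights-reindex {k} {l} {s} {t} {n} {r} α s<k t<l r≤n =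
  ≡.trans (rearrange ((k ∸ suc s + r) !) ((l ∸ suc t + (n ∸ r)) !) (r C α))
          (≡.cong₂ (λ x y → (r C α) * 1 * x ! * y !)
                   (≡.sym (m+n∸o∸1≡m∸suc[o]+n r s<k))
                   (≡.sym (≡.trans (≡.cong (λ m → m ∸ t ∸ 1) (+-∸-assoc l r≤n))
                                   (m+n∸o∸1≡m∸suc[o]+n (n ∸ r) t<l))))
  where
  rearrange : ∀ x y c → x * y * c ≡ c * 1 * x * y
  rearrange = solve-∀

m<n⇒m+0+o+p+1≤o+p+n : ∀ {m n} o p → m < n → m + 0 + o + p + 1 ≤ o + p + n
m<n⇒m+0+o+p+1≤o+p+n {m} o p m<n = ≤-trans (≤-reflexive (shift m o p)) (+-monoʳ-≤ (o + p) m<n)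
  where
  shift : ∀ m o p → m + 0 + o + p + 1 ≡ o + p + suc m
  shift = solve-∀

lemma3 : ∀ {c ℓ'} {{F : CharZeroField c ℓ'}} →
         (k l s t n : ℕ) → 1 ≤ k → 1 ≤ l → s ≤ k / 2 → t ≤ l / 2 → 1 ≤ n →
         (a : ℕ → Carrier) →
         (∀ u v α β → u ≤ s → v ≤ t → α + β + s + t + 1 ≤ u + v + n →
           sumTo (λ r → a r · fromℕ ((r C α) * ((n ∸ r) C β) * ((k + r ∸ u ∸ 1) !) * ((l + n ∸ r ∸ v ∸ 1) !))) n ≈ 0#) →
         ∃ λ (λ' : Carrier) → ∀ r → r ≤ n →
           a r ≈ λ' · (sign r · fromℕ (((k + n ∸ s ∸ 1) C (n ∸ r)) * ((l + n ∸ t ∸ 1) C r)))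
lemma3 {{F}} k l s t n 0<k 0<l s≤k/2 t≤l/2 _ a vanish =
  map₂ (λ a≈λ'·p r r≤n → trans (a≈λ'·p r r≤n) (*-congˡ (*-congˡ (fromℕ-cong (binomials≡ r)))))
       (vanishing-weighted-moments⇒binomial-form (k ∸ suc s) (l ∸ suc t) n a moments≈0)
  where
  open CharZeroField F using (commRing; sym; trans; *-congˡ; *-assoc)
  open BinomialMoments commRing using (fromℕ-cong; fromℕ-homo-*; sumTo-cong; moment)
  s<k : s < k
  s<k = m≤n/2⇒m<n 0<k s≤k/2
  t<l : t < l
  t<l = m≤n/2⇒m<n 0<l t≤l/2
  binomials≡ : ∀ r → ((k ∸ suc s + n) C (n ∸ r)) * ((l ∸ suc t + n) C r)
                     ≡ ((k + n ∸ s ∸ 1) C (n ∸ r)) * ((l + n ∸ t ∸ 1) C r)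
  binomials≡ r = ≡.sym (≡.cong₂ (λ x y → (x C (n ∸ r)) * (y C r))
                                (m+n∸o∸1≡m∸suc[o]+n n s<k) (m+n∸o∸1≡m∸suc[o]+n n t<l))
  moments≈0 : ∀ α → α < n →
              moment (λ r → a r · fromℕ ((k ∸ suc s + r) ! * (l ∸ suc t + (n ∸ r)) !)) n α ≈ 0#
  moments≈0 α α<n =
    trans (sumTo-cong n (λ r r≤n →
             trans (*-assoc _ _ _)
                   (*-congˡ (trans (sym (fromℕ-homo-* ((k ∸ suc s + r) ! * (l ∸ suc t + (n ∸ r)) !) (r C α)))
                                   (fromℕ-cong (factorial-weights-reindex α s<k t<l r≤n))))))
          (vanish s t α 0 ≤-refl ≤-refl (m<n⇒m+0+o+p+1≤o+p+n s t α<n))
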